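{- Let $\mathbf{s}=(s_1,\ldots,s_n)$ be a sequence of positive integers with $\gcd(s_i,s_{i+1})=1$ for $1\leq i<n$. Then $\mathcal{C}_n^{(\mathbf{s})}$ is Gorenstein if and only if $\mathbf{s}$ is $\mathbf{u}$-generated by some sequence $\mathbf{u}=(u_1,\ldots,u_{n-1})$ of positive integers. When such a sequence exists, the Gorenstein point $\mathbf{c}$ of $\mathcal{C}_n^{(\mathbf{s})}$ is given by $c_1=1$, $c_2=u_1$, and $c_{i+1}=u_ic_i-c_{i-1}$ for $2\leq i<n$.
   Context: $\mathcal{C}_n^{(\mathbf{s})}=\{\lambda\in\mathbb{R}^n: 0\leq\lambda_1/s_1\leq\cdots\leq\lambda_n/s_n\}$. A pointed rational cone $\mathcal{C}\subset\mathbb{R}^n$ is Gorenstein if there is an integer point $\mathbf{c}$ in the interior $\mathcal{C}^\circ$ such that $\mathcal{C}^\circ\cap\mathbb{Z}^n=\mathbf{c}+(\mathcal{C}\cap\mathbb{Z}^n)$; $\mathbf{c}$ is then called the Gorenstein point. A sequence $\mathbf{s}$ of positive integers is $\mathbf{u}$-generated by a sequence $\mathbf{u}$ of positive integers if $s_2=u_1s_1-1$ and $s_{i+1}=u_is_i-s_{i-1}$ for $i>1$. -}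

module Defs where

open import Data.Nat using (ℕ; suc)
import Data.Nat
open import Data.Integer using (ℤ; +_; _+_; _-_; _*_; _≤_; _<_; 0ℤ; 1ℤ)
open import Data.Fin using (Fin; zero; suc; inject₁)
open import Data.Product using (Σ; _×_)
open import Function.Bundles using (_⇔_)
open import Relation.Binary.PropositionalEquality using (_≡_)

-- Indices are 0-based: a sequence (x_1,…,x_n) with n = suc m is a function
-- Fin (suc m) → _, position k (0-based) holding x_{k+1}.
-- A point λ ∈ ℤ^n is a function Fin (suc m) → ℤ.

-- Integer points of the cone C_n^(s) = {λ : 0 ≤ λ₁/s₁ ≤ ⋯ ≤ λₙ/sₙ}.
-- Since all s_i > 0, λ_i/s_i ≤ λ_{i+1}/s_{i+1} is written as
-- λ_i * s_{i+1} ≤ λ_{i+1} * s_i, and 0 ≤ λ₁/s₁ as 0 ≤ λ₁.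
InCone : ∀ {m} → (Fin (Data.Nat.suc m) → ℕ) → (Fin (Data.Nat.suc m) → ℤ) → Set
InCone {m} s λ′ =
  (0ℤ ≤ λ′ zero) ×
  ((i : Fin m) → λ′ (inject₁ i) * + s (suc i) ≤ λ′ (suc i) * + s (inject₁ i))

InInterior : ∀ {m} → (Fin (Data.Nat.suc m) → ℕ) → (Fin (Data.Nat.suc m) → ℤ) → Set
InInterior {m} s λ′ =
  (0ℤ < λ′ zero) ×
  ((i : Fin m) → λ′ (inject₁ i) * + s (suc i) < λ′ (suc i) * + s (inject₁ i))

IsGorensteinPoint : ∀ {m} → (Fin (Data.Nat.suc m) → ℕ) → (Fin (Data.Nat.suc m) → ℤ) → Set
IsGorensteinPoint {m} s c =
  InInterior s c ×
  ((λ′ : Fin (Data.Nat.suc m) → ℤ) →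
     InInterior s λ′ ⇔
     Σ (Fin (Data.Nat.suc m) → ℤ) (λ μ → InCone s μ × ((i : Fin (Data.Nat.suc m)) → λ′ i ≡ c i + μ i)))

IsGorenstein : ∀ {m} → (Fin (Data.Nat.suc m) → ℕ) → Set
IsGorenstein {m} s = Σ (Fin (Data.Nat.suc m) → ℤ) (λ c → IsGorensteinPoint s c)

-- Three-term recurrence x_{i+1} = u_i x_i - x_{i-1} (1-based, i ≥ 1) with the
-- convention x_0 = a.  prev a x i is "x_{i-1}" for the step producing x_{i+1}.
prev : ∀ {m} → ℤ → (Fin (Data.Nat.suc m) → ℤ) → Fin m → ℤ
prev a x zero    = a
prev a x (suc j) = x (inject₁ (inject₁ j))

Recurrence : ∀ {m} → ℤ → (Fin m → ℕ) → (Fin (Data.Nat.suc m) → ℤ) → Set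
Recurrence {m} a u x = (i : Fin m) → x (suc i) ≡ + u i * x (inject₁ i) - prev a x i

-- s is u-generated: s₂ = u₁ s₁ - 1 and s_{i+1} = u_i s_i - s_{i-1} (i > 1),
-- i.e. the recurrence with convention s₀ = 1 (computed in ℤ).
UGenerated : ∀ {m} → (Fin (Data.Nat.suc m) → ℕ) → (Fin m → ℕ) → Set
UGenerated s u = Recurrence 1ℤ u (λ i → + s i)

-- The formula for the Gorenstein point: c₁ = 1, c₂ = u₁,
-- c_{i+1} = u_i c_i - c_{i-1} (2 ≤ i < n), i.e. the recurrence with c₀ = 0.
GorensteinFormula : ∀ {m} → (Fin m → ℕ) → (Fin (Data.Nat.suc m) → ℤ) → Set
GorensteinFormula u c = (c zero ≡ 1ℤ) × Recurrence 0ℤ u c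

module Submission where

open import Defs
open import Data.Nat using (ℕ; suc; _<_)
open import Data.Nat.GCD using (gcd)
open import Data.Integer using (ℤ)
open import Data.Fin using (Fin; suc; inject₁)
open import Data.Product using (Σ; _×_)
open import Function.Bundles using (_⇔_)
open import Relation.Binary.PropositionalEquality using (_≡_)

-- Theorem 2.8.  The cone C is cut out by the linear facet functionals
-- F₁(λ) = λ₁, F_{i+1}(λ) = λ_{i+1}s_i − λ_i s_{i+1}: the Wronskians of λ against s with
-- λ₀ = 0, s₀ = 1.  Lattice points of C have all F_k ≥ 0, those of C° all F_k ≥ 1.
--  (1) Gorenstein points are exactly the points with all facets equal to 1.  "⇐" holds
--      for any s, by translating by c.  "⇒": a Bézout identity for s_i, s_{i+1} yields a
--      lattice point violating facet k by exactly 1 and no other; if F_k(c) ≥ 2, adding it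
--      to c stays in C°, contradicting the Gorenstein property.
--  (2) If y obeys y_{i+1} = u_i y_i − y_{i−1}, the Wronskian of x against y changes at step
--      i by the defect of x in that recurrence times y_i.  So for u-generated s, unit
--      facets of c are equivalent to the Gorenstein formula.
--  (3) Unit facets force s to be u-generated: by Cramer's rule (c_{i+1} + c_{i−1},
--      s_{i+1} + s_{i−1}) is a positive integer multiple of (c_i, s_i).  Comments use the
-- paper's 1-based indices; the code is 0-based as in Defs (so λ₋₁ = 0, s₋₁ = 1).

open import Data.Nat using (z≤n; s≤s; >-nonZero)
import Data.Nat as ℕ
import Data.Nat.GCD as GCD
open import Data.Nat.Tactic.RingSolver using () renaming (solve-∀ to ℕ-solve-∀)
open import Data.Integer
  using (+_; +[1+_]; -[1+_]; ∣_∣; _+_; _-_; _*_; -_; _≤_; +≤+; 0ℤ; 1ℤ; -1ℤ)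
  renaming (_<_ to _<ℤ_; suc to sucℤ)
open import Data.Integer.Properties
  using ( ≤-refl; ≤-reflexive; ≤-antisym; ≮⇒≥; +-mono-≤; +-monoˡ-≤
        ; *-monoˡ-≤-nonNeg; *-monoʳ-≤-nonNeg; *-cancelʳ-≡; *-identityʳ; +-identityʳ; pos-*
        ; i<j⇒suc[i]≤j; suc[i]≤j⇒i<j; i≤j⇒0≤j-i; 0≤i-j⇒j≤i; i≡j⇒i-j≡0; i-j≡0⇒i≡j
        ; +-0-abelianGroup)
open import Algebra.Properties.AbelianGroup +-0-abelianGroup using (∙-cancelˡ)
open import Data.Integer.Tactic.RingSolver using (solve-∀)
open import Data.Fin using (zero)
open import Data.Vec.Functional using (_∷_)
open import Data.Product using (_,_; proj₁; proj₂)
open import Data.Sum using (_⊎_; inj₁; inj₂)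
open import Data.Empty using (⊥)
open import Relation.Nullary using (¬_)
open import Function.Base using (_∘_)
open import Function.Bundles using (mk⇔; Equivalence)
open import Relation.Binary.PropositionalEquality using (refl; sym; trans; cong; cong₂; subst; module ≡-Reasoning)
open ≡-Reasoning

<⇒1≤- : ∀ {a b} → a <ℤ b → 1ℤ ≤ b - a
<⇒1≤- {a} {b} a<b = subst (_≤ b - a) (cancel a) (+-monoˡ-≤ (- a) (i<j⇒suc[i]≤j a<b))
  where
  cancel : ∀ a → (1ℤ + a) - a ≡ 1ℤ
  cancel = solve-∀

1≤-⇒< : ∀ {a b} → 1ℤ ≤ b - a → a <ℤ b
1≤-⇒< {a} {b} 1≤b-a = suc[i]≤j⇒i<j (subst (sucℤ a ≤_) (cancel a b) (+-monoˡ-≤ a 1≤b-a))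
  where
  cancel : ∀ a b → (b - a) + a ≡ b
  cancel = solve-∀

-- Wronskians and the facet functionals

before : ∀ {m} → ℤ → (Fin (suc m) → ℤ) → Fin (suc m) → ℤ
before a x zero    = a
before a x (suc i) = x (inject₁ i)

before-inject₁ : ∀ {m} a (x : Fin (suc m) → ℤ) (i : Fin m) → before a x (inject₁ i) ≡ prev a x i
before-inject₁ a x zero    = refl
before-inject₁ a x (suc i) = refl

wronskian : ∀ {m} → ℤ → (Fin (suc m) → ℤ) → ℤ → (Fin (suc m) → ℤ) → Fin (suc m) → ℤ
wronskian a x b y k = x k * before b y k - before a x k * y k

wronskian-inject₁ : ∀ {m} a (x : Fin (suc m) → ℤ) b y (i : Fin m) →
                    wronskian a x b y (inject₁ i) ≡ x (inject₁ i) * prev b y i - prev a x i * y (inject₁ i)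
wronskian-inject₁ a x b y i =
  cong₂ (λ q p → x (inject₁ i) * q - p * y (inject₁ i)) (before-inject₁ b y i) (before-inject₁ a x i)

facet : ∀ {m} → (Fin (suc m) → ℕ) → (Fin (suc m) → ℤ) → Fin (suc m) → ℤ
facet s λ′ = wronskian 0ℤ λ′ 1ℤ (λ i → + s i)

facet-zero : ∀ {m} (s : Fin (suc m) → ℕ) λ′ → facet s λ′ zero ≡ λ′ zero
facet-zero s λ′ = identity (λ′ zero) (+ s zero)
  where
  identity : ∀ x y → x * 1ℤ - 0ℤ * y ≡ x
  identity = solve-∀

facet-additive : ∀ {m} s (λ′ c μ : Fin (suc m) → ℤ) → (∀ i → λ′ i ≡ c i + μ i) →
                 ∀ k → facet s λ′ k ≡ facet s c k + facet s μ k
facet-additive s λ′ c μ sum k = begin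
  λ′ k * t - before 0ℤ λ′ k * y                          ≡⟨ cong₂ (λ a b → a * t - b * y) (sum k) (before-sum k) ⟩
  (c k + μ k) * t - (before 0ℤ c k + before 0ℤ μ k) * y  ≡⟨ identity (c k) (μ k) (before 0ℤ c k) (before 0ℤ μ k) t y ⟩
  facet s c k + facet s μ k                              ∎
  where
  t = before 1ℤ (λ i → + s i) k
  y = + s k
  before-sum : ∀ k → before 0ℤ λ′ k ≡ before 0ℤ c k + before 0ℤ μ k
  before-sum zero    = refl
  before-sum (suc i) = sum (inject₁ i)
  identity : ∀ a b p q t y → (a + b) * t - (p + q) * y ≡ (a * t - p * y) + (b * t - q * y)
  identity = solve-∀

cone⇔facets : ∀ {m} s λ′ → InCone {m} s λ′ ⇔ (∀ k → 0ℤ ≤ facet s λ′ k)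
cone⇔facets s λ′ = mk⇔ to from
  where
  to : InCone s λ′ → ∀ k → 0ℤ ≤ facet s λ′ k
  to (0≤λ₀ , _) zero    = subst (0ℤ ≤_) (sym (facet-zero s λ′)) 0≤λ₀
  to (_ , ordered) (suc i) = i≤j⇒0≤j-i (ordered i)
  from : (∀ k → 0ℤ ≤ facet s λ′ k) → InCone s λ′
  from F≥0 = subst (0ℤ ≤_) (facet-zero s λ′) (F≥0 zero) , λ i → 0≤i-j⇒j≤i (F≥0 (suc i))

interior⇔facets : ∀ {m} s λ′ → InInterior {m} s λ′ ⇔ (∀ k → 1ℤ ≤ facet s λ′ k)
interior⇔facets s λ′ = mk⇔ to from
  where
  to : InInterior s λ′ → ∀ k → 1ℤ ≤ facet s λ′ k
  to (0<λ₀ , _) zero    = subst (1ℤ ≤_) (sym (facet-zero s λ′)) (i<j⇒suc[i]≤j 0<λ₀)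
  to (_ , ordered) (suc i) = <⇒1≤- (ordered i)
  from : (∀ k → 1ℤ ≤ facet s λ′ k) → InInterior s λ′
  from F≥1 = suc[i]≤j⇒i<j (subst (1ℤ ≤_) (facet-zero s λ′) (F≥1 zero)) , λ i → 1≤-⇒< (F≥1 (suc i))

-- Part (1): Gorenstein points are the points with unit facets

UnitFacets : ∀ {m} → (Fin (suc m) → ℕ) → (Fin (suc m) → ℤ) → Set
UnitFacets s c = ∀ k → facet s c k ≡ 1ℤ

-- Valid for every s: translation by a point with unit facets shifts the
-- facet values by exactly 1, mapping C ∩ ℤⁿ onto C° ∩ ℤⁿ.
unit-facets⇒gorenstein : ∀ {m} s (c : Fin (suc m) → ℤ) → UnitFacets s c → IsGorensteinPoint s c
unit-facets⇒gorenstein s c unit =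
  Equivalence.from (interior⇔facets s c) (λ k → ≤-reflexive (sym (unit k))) , λ λ′ → mk⇔ (split λ′) (shift λ′)
  where
  shifted : ∀ λ′ μ → (∀ i → λ′ i ≡ c i + μ i) → ∀ k → facet s λ′ k ≡ 1ℤ + facet s μ k
  shifted λ′ μ sum k = trans (facet-additive s λ′ c μ sum k) (cong (_+ facet s μ k) (unit k))
  split : ∀ λ′ → InInterior s λ′ → Σ _ (λ μ → InCone s μ × (∀ i → λ′ i ≡ c i + μ i))
  split λ′ interior = μ , Equivalence.from (cone⇔facets s μ) μ≥0 , difference
    where
    μ : Fin _ → ℤ
    μ i = λ′ i - c i
    difference : ∀ i → λ′ i ≡ c i + (λ′ i - c i)
    difference i = identity (λ′ i) (c i)
      where
      identity : ∀ a b → a ≡ b + (a - b)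
      identity = solve-∀
    μ≥0 : ∀ k → 0ℤ ≤ facet s μ k
    μ≥0 k = subst (0ℤ ≤_) (identity F) (i≤j⇒0≤j-i λ≥1)
      where
      F = facet s μ k
      λ≥1 : 1ℤ ≤ 1ℤ + F
      λ≥1 = subst (1ℤ ≤_) (shifted λ′ μ difference k) (Equivalence.to (interior⇔facets s λ′) interior k)
      identity : ∀ a → (1ℤ + a) - 1ℤ ≡ a
      identity = solve-∀
  shift : ∀ λ′ → Σ _ (λ μ → InCone s μ × (∀ i → λ′ i ≡ c i + μ i)) → InInterior s λ′
  shift λ′ (μ , cone , sum) = Equivalence.from (interior⇔facets s λ′) λ k →
    subst (1ℤ ≤_) (sym (shifted λ′ μ sum k)) (+-mono-≤ (≤-refl {1ℤ}) (Equivalence.to (cone⇔facets s μ) cone k))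

Separating : ∀ {m} → (Fin (suc m) → ℕ) → Fin (suc m) → (Fin (suc m) → ℤ) → Set
Separating s k₀ y = (facet s y k₀ ≡ -1ℤ) × (∀ k → k ≡ k₀ ⊎ 0ℤ ≤ facet s y k)

-1-negative : ¬ (0ℤ ≤ -1ℤ)
-1-negative ()

-- If F_{k₀}(c) ≥ 2 and y separates facet k₀, then c + y is an interior point
-- whose difference y from c is not in the cone; so a Gorenstein point has F_{k₀}(c) ≤ 1.
no-room-above : ∀ {m} s (c y : Fin (suc m) → ℤ) k₀ → IsGorensteinPoint s c →
                Separating s k₀ y → ¬ (1ℤ <ℤ facet s c k₀)
no-room-above s c y k₀ (interior , gorenstein) (y-value , y-others) 1<F = μ-not-in-cone
  where
  c≥1 : ∀ k → 1ℤ ≤ facet s c k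
  c≥1 = Equivalence.to (interior⇔facets s c) interior
  l : Fin _ → ℤ
  l i = c i + y i
  l-facets : ∀ k → facet s l k ≡ facet s c k + facet s y k
  l-facets = facet-additive s l c y (λ _ → refl)
  l≥1 : ∀ k → 1ℤ ≤ facet s l k
  l≥1 k with y-others k
  ... | inj₁ refl = subst (1ℤ ≤_) (sym (trans (l-facets k₀) (cong (λ t → facet s c k₀ + t) y-value))) (<⇒1≤- 1<F)
  ... | inj₂ y≥0 = subst (1ℤ ≤_) (sym (l-facets k)) (+-mono-≤ (c≥1 k) y≥0)
  decomposition : Σ _ (λ μ → InCone s μ × (∀ i → l i ≡ c i + μ i))
  decomposition = Equivalence.to (gorenstein l) (Equivalence.from (interior⇔facets s l) l≥1)
  μ = proj₁ decomposition
  μ-facet : facet s μ k₀ ≡ -1ℤ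
  μ-facet = trans (∙-cancelˡ (facet s c k₀) _ _
                    (trans (sym (facet-additive s l c μ (proj₂ (proj₂ decomposition)) k₀)) (l-facets k₀)))
                  y-value
  μ-not-in-cone : ⊥
  μ-not-in-cone = -1-negative (subst (0ℤ ≤_) μ-facet (Equivalence.to (cone⇔facets s μ) (proj₁ (proj₂ decomposition)) k₀))

gorenstein⇒unit-facet : ∀ {m} s (c y : Fin (suc m) → ℤ) k₀ → IsGorensteinPoint s c →
                        Separating s k₀ y → facet s c k₀ ≡ 1ℤ
gorenstein⇒unit-facet s c y k₀ gorenstein separating =
  ≤-antisym (≮⇒≥ (no-room-above s c y k₀ gorenstein separating))
            (Equivalence.to (interior⇔facets s c) (proj₁ gorenstein) k₀)

first-separator : ∀ {m} → Fin (suc m) → ℤ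
first-separator = -1ℤ ∷ λ _ → 0ℤ

separating-first : ∀ {m} s → Separating {m} s zero first-separator
separating-first s = facet-zero s first-separator , others
  where
  others : ∀ k → k ≡ zero ⊎ 0ℤ ≤ facet s first-separator k
  others zero          = inj₁ refl
  others (suc zero)    = inj₂ (subst (0ℤ ≤_) (sym (identity (+ s zero) (+ s (suc zero)))) (+≤+ z≤n))
    where
    identity : ∀ a b → 0ℤ * a - (- 1ℤ) * b ≡ b
    identity = solve-∀
  others (suc (suc j)) = inj₂ (≤-reflexive (sym (identity (+ s (suc (inject₁ j))) (+ s (suc (suc j))))))
    where
    identity : ∀ a b → 0ℤ * a - 0ℤ * b ≡ 0ℤ
    identity = solve-∀

difference-minus-one : ∀ x y → 1ℤ + x ≡ y → x - y ≡ -1ℤ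
difference-minus-one x y refl = identity x
  where
  identity : ∀ x → x - (1ℤ + x) ≡ - 1ℤ
  identity = solve-∀

-- Given 1 + α s₁ = β s₂, the point (β, α, α s₃, …, α sₙ) separates the facet
-- λ₁/s₁ ≤ λ₂/s₂: its later ratios α s_j / s_j = α ≥ α/s₂ satisfy the other facets.
second-separator : ∀ {m} → (Fin (suc (suc m)) → ℕ) → ℕ → ℕ → Fin (suc (suc m)) → ℤ
second-separator s α β = + β ∷ + α ∷ λ j → + (α ℕ.* s (suc (suc j)))

separating-second : ∀ {m} s α β → 0 < s (suc zero) → 1ℤ + + α * + s zero ≡ + β * + s (suc zero) →
                    Separating {suc m} s (suc zero) (second-separator s α β)
separating-second s α β s₂>0 bezout = difference-minus-one (+ α * + s zero) (+ β * + s (suc zero)) bezout , others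
  where
  y = second-separator s α β
  others : ∀ k → k ≡ suc zero ⊎ 0ℤ ≤ facet s y k
  others zero                = inj₂ (subst (0ℤ ≤_) (sym (facet-zero s y)) (+≤+ z≤n))
  others (suc zero)          = inj₁ refl
  others (suc (suc zero))    = inj₂ (i≤j⇒0≤j-i (subst (_≤ A * + s (suc zero))
                                                         (trans (*-identityʳ A) (pos-* α (s (suc (suc zero)))))
                                                         (*-monoˡ-≤-nonNeg A (+≤+ s₂>0))))
    where
    A = + (α ℕ.* s (suc (suc zero)))
  others (suc (suc (suc j))) = inj₂ (≤-reflexive (sym (trans
    (cong₂ (λ p q → p * + s (suc (suc (inject₁ j))) - q * + s (suc (suc (suc j))))
           (pos-* α (s (suc (suc (suc j))))) (pos-* α (s (suc (suc (inject₁ j))))))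
    (identity (+ α) (+ s (suc (suc (suc j)))) (+ s (suc (suc (inject₁ j))))))))
    where
    identity : ∀ a b c → (a * b) * c - (a * c) * b ≡ 0ℤ
    identity = solve-∀

separating-shift : ∀ {m} s (i : Fin m) y → Separating (s ∘ suc) (suc i) y →
                   Separating {suc m} s (suc (suc i)) (0ℤ ∷ y)
separating-shift s i y (value , y-others) = value , others
  where
  y₀≥0 : 0ℤ ≤ y zero
  y₀≥0 with y-others zero
  ... | inj₁ ()
  ... | inj₂ F₀≥0 = subst (0ℤ ≤_) (facet-zero (s ∘ suc) y) F₀≥0
  others : ∀ k → k ≡ suc (suc i) ⊎ 0ℤ ≤ facet s (0ℤ ∷ y) k
  others zero          = inj₂ (subst (0ℤ ≤_) (sym (facet-zero s (0ℤ ∷ y))) ≤-refl)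
  others (suc zero)    = inj₂ (subst (0ℤ ≤_) (sym (identity (y zero) (+ s zero) (+ s (suc zero))))
                                     (*-monoʳ-≤-nonNeg (+ s zero) y₀≥0))
    where
    identity : ∀ a b c → a * b - 0ℤ * c ≡ a * b
    identity = solve-∀
  others (suc (suc j)) with y-others (suc j)
  ... | inj₁ j≡i = inj₁ (cong suc j≡i)
  ... | inj₂ F≥0 = inj₂ F≥0

-- The library
-- may return the opposite convention 1 + y b = x a; then (α, β) = (b′x + b y, a x + a′y),
-- where a = 1 + a′ and b = 1 + b′, works since β b − α a = x a − y b.
bezout : ∀ a b → 0 < a → 0 < b → gcd a b ≡ 1 → Σ ℕ λ α → Σ ℕ λ β → 1 ℕ.+ α ℕ.* a ≡ β ℕ.* b
bezout a b _ _ coprime with subst (λ d → GCD.Bézout.Identity d a b) coprime (GCD.Bézout.identity (GCD.gcd-GCD a b))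
... | GCD.Bézout.-+ x y eq = x , y , eq
bezout (suc a′) (suc b′) _ _ _ | GCD.Bézout.+- x y eq =
  b′ ℕ.* x ℕ.+ suc b′ ℕ.* y , suc a′ ℕ.* x ℕ.+ a′ ℕ.* y , sym (begin
    (suc a′ ℕ.* x ℕ.+ a′ ℕ.* y) ℕ.* suc b′            ≡⟨ expand a′ b′ x y ⟩
    x ℕ.* suc a′ ℕ.+ rest                            ≡⟨ cong (ℕ._+ rest) (sym eq) ⟩
    (1 ℕ.+ y ℕ.* suc b′) ℕ.+ rest                    ≡⟨ collect a′ b′ x y ⟩
    1 ℕ.+ (b′ ℕ.* x ℕ.+ suc b′ ℕ.* y) ℕ.* suc a′     ∎)
  where
  rest = b′ ℕ.* x ℕ.* suc a′ ℕ.+ a′ ℕ.* y ℕ.* suc b′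
  expand : ∀ a′ b′ x y → ((1 ℕ.+ a′) ℕ.* x ℕ.+ a′ ℕ.* y) ℕ.* (1 ℕ.+ b′)
                         ≡ x ℕ.* (1 ℕ.+ a′) ℕ.+ (b′ ℕ.* x ℕ.* (1 ℕ.+ a′) ℕ.+ a′ ℕ.* y ℕ.* (1 ℕ.+ b′))
  expand = ℕ-solve-∀
  collect : ∀ a′ b′ x y → (1 ℕ.+ y ℕ.* (1 ℕ.+ b′)) ℕ.+ (b′ ℕ.* x ℕ.* (1 ℕ.+ a′) ℕ.+ a′ ℕ.* y ℕ.* (1 ℕ.+ b′))
                          ≡ 1 ℕ.+ (b′ ℕ.* x ℕ.+ (1 ℕ.+ b′) ℕ.* y) ℕ.* (1 ℕ.+ a′)
  collect = ℕ-solve-∀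

separating-wall : ∀ {m} s → (∀ i → 0 < s i) → (i : Fin m) → ∀ α β →
                  1ℤ + + α * + s (inject₁ i) ≡ + β * + s (suc i) → Σ _ (Separating s (suc i))
separating-wall s pos zero    α β bezout = second-separator s α β , separating-second s α β (pos (suc zero)) bezout
separating-wall s pos (suc i) α β bezout with separating-wall (s ∘ suc) (pos ∘ suc) i α β bezout
... | y , separating = 0ℤ ∷ y , separating-shift s i y separating

separating-point : ∀ {m} s → (∀ i → 0 < s i) → ((i : Fin m) → gcd (s (inject₁ i)) (s (suc i)) ≡ 1) →
                   ∀ k → Σ _ (Separating s k)
separating-point s pos coprime zero    = first-separator , separating-first s
separating-point s pos coprime (suc i) with bezout (s (inject₁ i)) (s (suc i)) (pos (inject₁ i)) (pos (suc i)) (coprime i)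
... | α , β , eq = separating-wall s pos i α β (trans (cong (λ t → 1ℤ + t) (sym (pos-* α (s (inject₁ i)))))
                                                       (trans (cong +_ eq) (pos-* β (s (suc i)))))

gorenstein⇒unit-facets : ∀ {m} s → (∀ i → 0 < s i) → ((i : Fin m) → gcd (s (inject₁ i)) (s (suc i)) ≡ 1) →
                         ∀ c → IsGorensteinPoint s c → UnitFacets s c
gorenstein⇒unit-facets s pos coprime c gorenstein k with separating-point s pos coprime k
... | y , separating = gorenstein⇒unit-facet s c y k gorenstein separating

-- Part (2): the Wronskian along a three-term recurrence

defect : ∀ {m} → ℤ → (Fin m → ℕ) → (Fin (suc m) → ℤ) → Fin m → ℤ
defect a u x i = x (suc i) - (+ u i * x (inject₁ i) - prev a x i)

wronskian-step : ∀ {m} a b (u : Fin m → ℕ) x y → Recurrence b u y → ∀ i →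
                 wronskian a x b y (suc i) ≡ wronskian a x b y (inject₁ i) + defect a u x i * y (inject₁ i)
wronskian-step a b u x y recurrence i = begin
  x′ * y₀ - x₀ * y (suc i)                     ≡⟨ cong (λ t → x′ * y₀ - x₀ * t) (recurrence i) ⟩
  x′ * y₀ - x₀ * (U * y₀ - q)                  ≡⟨ identity x₀ x′ p y₀ q U ⟩
  (x₀ * q - p * y₀) + (x′ - (U * x₀ - p)) * y₀  ≡⟨ cong (λ t → t + (x′ - (U * x₀ - p)) * y₀) (sym (wronskian-inject₁ a x b y i)) ⟩
  wronskian a x b y (inject₁ i) + (x′ - (U * x₀ - p)) * y₀ ∎
  where
  x₀ = x (inject₁ i)
  x′ = x (suc i)
  y₀ = y (inject₁ i)
  p = prev a x i
  q = prev b y i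
  U = + u i
  identity : ∀ x₀ x′ p y₀ q U → x′ * y₀ - x₀ * (U * y₀ - q) ≡ (x₀ * q - p * y₀) + (x′ - (U * x₀ - p)) * y₀
  identity = solve-∀

constant : ∀ {a} {A : Set a} {m} (g : Fin (suc m) → A) → (∀ i → g (suc i) ≡ g (inject₁ i)) → ∀ k → g k ≡ g zero
constant g step zero = refl
constant {m = suc m} g step (suc i) = trans (step i) (constant (g ∘ inject₁) (step ∘ inject₁) i)

-- For u-generated s, the Gorenstein formula makes all facets equal to c₁ = 1:
-- the defect vanishes, so the Wronskian of c against s is constant.
formula⇒unit-facets : ∀ {m} s u (c : Fin (suc m) → ℤ) → UGenerated s u → GorensteinFormula u c → UnitFacets s c
formula⇒unit-facets s u c generated (c₀≡1 , recurrence) k = begin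
  facet s c k    ≡⟨ constant (facet s c) step k ⟩
  facet s c zero ≡⟨ facet-zero s c ⟩
  c zero         ≡⟨ c₀≡1 ⟩
  1ℤ             ∎
  where
  step : ∀ i → facet s c (suc i) ≡ facet s c (inject₁ i)
  step i = begin
    facet s c (suc i)                                      ≡⟨ wronskian-step 0ℤ 1ℤ u c _ generated i ⟩
    facet s c (inject₁ i) + defect 0ℤ u c i * + s (inject₁ i) ≡⟨ cong (λ d → facet s c (inject₁ i) + d * + s (inject₁ i))
                                                                       (i≡j⇒i-j≡0 (recurrence i)) ⟩
    facet s c (inject₁ i) + 0ℤ * + s (inject₁ i)            ≡⟨ +-identityʳ (facet s c (inject₁ i)) ⟩
    facet s c (inject₁ i)                                   ∎

-- Conversely, for u-generated positive s, unit facets force c₁ = 1 and a vanishing defect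
-- (the step of the constant Wronskian is the defect times s_i ≠ 0).
unit-facets⇒formula : ∀ {m} s → (∀ i → 0 < s i) → ∀ u (c : Fin (suc m) → ℤ) →
                      UGenerated s u → UnitFacets s c → GorensteinFormula u c
unit-facets⇒formula s pos u c generated unit = trans (sym (facet-zero s c)) (unit zero) , recurrence
  where
  recurrence : ∀ i → c (suc i) ≡ + u i * c (inject₁ i) - prev 0ℤ c i
  recurrence i = i-j≡0⇒i≡j _ _ (*-cancelʳ-≡ d 0ℤ (+ s (inject₁ i)) {{>-nonZero (pos (inject₁ i))}} weighted)
    where
    d = defect 0ℤ u c i
    weighted : d * + s (inject₁ i) ≡ 0ℤ * + s (inject₁ i)
    weighted = ∙-cancelˡ 1ℤ _ _ (begin
      1ℤ + d * + s (inject₁ i)                    ≡⟨ cong (λ t → t + d * + s (inject₁ i)) (sym (unit (inject₁ i))) ⟩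
      facet s c (inject₁ i) + d * + s (inject₁ i) ≡⟨ sym (wronskian-step 0ℤ 1ℤ u c _ generated i) ⟩
      facet s c (suc i)                           ≡⟨ unit (suc i) ⟩
      1ℤ                                          ∎)

-- Part (3): unit facets force s to be u-generated

-- Cramer's rule for consecutive columns: if x′y − xy′ = 1 and xq − py = 1, then
-- (x′ + p, y′ + q) = U·(x, y) with U = (x′ + p) q − p (y′ + q); we use the second coordinate.
cramer : ∀ x x′ p y y′ q → x′ * y - x * y′ ≡ 1ℤ → x * q - p * y ≡ 1ℤ →
         ((x′ + p) * q - p * (y′ + q)) * y ≡ y′ + q
cramer x x′ p y y′ q D₁≡1 D₀≡1 = begin
  ((x′ + p) * q - p * (y′ + q)) * y                                        ≡⟨ expand x x′ p y y′ q ⟩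
  y′ + q + (q * ((x′ * y - x * y′) - 1ℤ) + y′ * ((x * q - p * y) - 1ℤ))  ≡⟨ cong₂ (λ d₁ d₀ → y′ + q + (q * (d₁ - 1ℤ) + y′ * (d₀ - 1ℤ))) D₁≡1 D₀≡1 ⟩
  y′ + q + (q * (1ℤ - 1ℤ) + y′ * (1ℤ - 1ℤ))                                ≡⟨ collapse (y′ + q) q y′ ⟩
  y′ + q                                                                   ∎
  where
  expand : ∀ x x′ p y y′ q → ((x′ + p) * q - p * (y′ + q)) * y
                             ≡ y′ + q + (q * ((x′ * y - x * y′) - 1ℤ) + y′ * ((x * q - p * y) - 1ℤ))
  expand = solve-∀
  collapse : ∀ a q y′ → a + (q * (1ℤ - 1ℤ) + y′ * (1ℤ - 1ℤ)) ≡ a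
  collapse = solve-∀

positive-factor : ∀ U y → 0 < y → 1ℤ ≤ U * + y → 0 < ∣ U ∣ × + ∣ U ∣ ≡ U
positive-factor +[1+ n ] y       _ _          = s≤s z≤n , refl
positive-factor (+ 0)    (suc y) _ (+≤+ ())
positive-factor -[1+ n ] (suc y) _ ()

prev-nonneg : ∀ {m} (s : Fin (suc m) → ℕ) i → 0ℤ ≤ prev 1ℤ (λ j → + s j) i
prev-nonneg s zero    = +≤+ z≤n
prev-nonneg s (suc i) = +≤+ z≤n

-- With unit facets, Cramer's rule gives u_i s_i = s_{i+1} + s_{i−1} for an integer u_i,
-- which is a positive natural number because the right-hand side is positive.
unit-facets⇒u-generated : ∀ {m} s → (∀ i → 0 < s i) → (c : Fin (suc m) → ℤ) → UnitFacets s c →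
                          Σ (Fin m → ℕ) (λ u → ((i : Fin m) → 0 < u i) × UGenerated s u)
unit-facets⇒u-generated {m} s pos c unit = (λ i → ∣ U i ∣) , (λ i → proj₁ (U-natural i)) , generated
  where
  s′ : Fin (suc m) → ℤ
  s′ j = + s j
  U : Fin m → ℤ
  U i = (c (suc i) + prev 0ℤ c i) * prev 1ℤ s′ i - prev 0ℤ c i * (s′ (suc i) + prev 1ℤ s′ i)
  U-scales : ∀ i → U i * s′ (inject₁ i) ≡ s′ (suc i) + prev 1ℤ s′ i
  U-scales i = cramer (c (inject₁ i)) (c (suc i)) (prev 0ℤ c i) (s′ (inject₁ i)) (s′ (suc i)) (prev 1ℤ s′ i)
                      (unit (suc i)) (trans (sym (wronskian-inject₁ 0ℤ c 1ℤ s′ i)) (unit (inject₁ i)))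
  U-natural : ∀ i → 0 < ∣ U i ∣ × + ∣ U i ∣ ≡ U i
  U-natural i = positive-factor (U i) (s (inject₁ i)) (pos (inject₁ i))
    (subst (1ℤ ≤_) (sym (U-scales i)) (+-mono-≤ (+≤+ (pos (suc i))) (prev-nonneg s i)))
  generated : UGenerated s (λ i → ∣ U i ∣)
  generated i = begin
    s′ (suc i)                                  ≡⟨ sym (identity (s′ (suc i)) q) ⟩
    (s′ (suc i) + q) - q                        ≡⟨ cong (_- q) (sym (U-scales i)) ⟩
    U i * s′ (inject₁ i) - q                    ≡⟨ cong (λ t → t * s′ (inject₁ i) - q) (sym (proj₂ (U-natural i))) ⟩
    + ∣ U i ∣ * s′ (inject₁ i) - q              ∎
    where
    q = prev 1ℤ s′ i
    identity : ∀ a q → (a + q) - q ≡ a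
    identity = solve-∀

recurrence-solution : ∀ m → (Fin m → ℕ) → ℤ → ℤ → Fin (suc m) → ℤ
recurrence-solution m       u a x₀ zero    = x₀
recurrence-solution (suc m) u a x₀ (suc k) = recurrence-solution m (u ∘ suc) x₀ (+ u zero * x₀ - a) k

recurrence-solution-solves : ∀ m u a x₀ → Recurrence a u (recurrence-solution m u a x₀)
recurrence-solution-solves (suc m) u a x₀ zero          = refl
recurrence-solution-solves (suc m) u a x₀ (suc zero)    = recurrence-solution-solves m (u ∘ suc) x₀ (+ u zero * x₀ - a) zero
recurrence-solution-solves (suc m) u a x₀ (suc (suc j)) = recurrence-solution-solves m (u ∘ suc) x₀ (+ u zero * x₀ - a) (suc j)

theorem2p8 : (m : ℕ) (s : Fin (suc m) → ℕ) →
    ((i : Fin (suc m)) → 0 < s i) →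
    ((i : Fin m) → gcd (s (inject₁ i)) (s (suc i)) ≡ 1) →
    (IsGorenstein s ⇔ Σ (Fin m → ℕ) (λ u → ((i : Fin m) → 0 < u i) × UGenerated s u))
    × ((u : Fin m → ℕ) → ((i : Fin m) → 0 < u i) → UGenerated s u →
       (c : Fin (suc m) → ℤ) → (IsGorensteinPoint s c ⇔ GorensteinFormula u c))
theorem2p8 m s pos coprime = mk⇔ gorenstein⇒generated generated⇒gorenstein , point⇔formula
  where
  gorenstein⇒generated : IsGorenstein s → Σ (Fin m → ℕ) (λ u → ((i : Fin m) → 0 < u i) × UGenerated s u)
  gorenstein⇒generated (c , gorenstein) =
    unit-facets⇒u-generated s pos c (gorenstein⇒unit-facets s pos coprime c gorenstein)
  generated⇒gorenstein : Σ (Fin m → ℕ) (λ u → ((i : Fin m) → 0 < u i) × UGenerated s u) → IsGorenstein s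
  generated⇒gorenstein (u , _ , generated) = c , unit-facets⇒gorenstein s c (formula⇒unit-facets s u c generated formula)
    where
    c = recurrence-solution m u 0ℤ 1ℤ
    formula : GorensteinFormula u c
    formula = refl , recurrence-solution-solves m u 0ℤ 1ℤ
  point⇔formula : (u : Fin m → ℕ) → ((i : Fin m) → 0 < u i) → UGenerated s u →
                  (c : Fin (suc m) → ℤ) → (IsGorensteinPoint s c ⇔ GorensteinFormula u c)
  point⇔formula u _ generated c =
    mk⇔ (unit-facets⇒formula s pos u c generated ∘ gorenstein⇒unit-facets s pos coprime c)
        (unit-facets⇒gorenstein s c ∘ formula⇒unit-facets s u c generated)
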